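{- Let $Q_n$ be the para-chain square cactus with $n$ squares. Then for every $n\ge 1$ and $k\ge 1$: (i) $Mo(Q_n)=24k^2$ if $n=2k$, and $Mo(Q_n)=24k^2+24k$ if $n=2k+1$; (ii) $Mo_e(Q_n)=32k^2$ if $n=2k$, and $Mo_e(Q_n)=32k^2+32k$ if $n=2k+1$.
   Context: The para-chain square cactus $Q_n$ consists of $n$ 4-cycles (squares) $S_1,\ldots,S_n$ such that $S_i$ and $S_{i+1}$ share exactly one vertex for $i=1,\ldots,n-1$, non-consecutive squares are vertex-disjoint, and for $2\le i\le n-1$ the vertex $S_i$ shares with $S_{i-1}$ and the vertex it shares with $S_{i+1}$ are opposite (non-adjacent) vertices of $S_i$. For a graph $G$ and an edge $e=uv$, $n_u(e,G)$ denotes the number of vertices of $G$ strictly closer to $u$ than to $v$ (and $n_v(e,G)$ analogously). The Mostar index is $Mo(G)=\sum_{uv\in E(G)}|n_u(uv,G)-n_v(uv,G)|$. For a vertex $w$ and an edge $f=ab$ put $d(w,f)=\min\{d(w,a),d(w,b)\}$; $m_u(e|G)$ is the number of edges $f$ of $G$ with $d(u,f)<d(v,f)$, and $m_v(e|G)$ analogously. The edge Mostar index is $Mo_e(G)=\sum_{e=uv\in E(G)}|m_u(e|G)-m_v(e|G)|$. -}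

module Defs where

open import Data.Nat using (ℕ; zero; suc; _+_; _*_; _<ᵇ_; _≡ᵇ_; _⊓_; ∣_-_∣)
open import Data.Bool using (Bool; true; false; _∧_; _∨_; if_then_else_)
open import Data.List using (List; []; _∷_; _++_; map; upTo; concatMap; length)
open import Data.Bool.ListAction using (any)
open import Data.Nat.ListAction using (sum)
open import Data.Product using (_×_; _,_; proj₁; proj₂)
open import Relation.Nullary.Decidable using (does)
open import Relation.Unary using (Pred)

-- Finite simple graphs: vertices 0 … V-1, edges given as an edge list.

record Graph : Set where
  constructor mkGraph
  field
    V : ℕ
    E : List (ℕ × ℕ)
open Graph public

filterᵇ : {A : Set} → (A → Bool) → List A → List A
filterᵇ p [] = []
filterᵇ p (x ∷ xs) = if p x then x ∷ filterᵇ p xs else filterᵇ p xs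

vertices : Graph → List ℕ
vertices G = upTo (V G)

adj : Graph → ℕ → ℕ → Bool
adj G u v = any (λ e → ((proj₁ e ≡ᵇ u) ∧ (proj₂ e ≡ᵇ v)) ∨ ((proj₁ e ≡ᵇ v) ∧ (proj₂ e ≡ᵇ u))) (E G)

_∈ᵇ_ : ℕ → List ℕ → Bool
x ∈ᵇ xs = any (λ y → x ≡ᵇ y) xs

ball : Graph → ℕ → ℕ → List ℕ
ball G zero u = u ∷ []
ball G (suc k) u =
  filterᵇ (λ w → w ∈ᵇ ball G k u ∨ any (λ x → adj G x w) (ball G k u)) (vertices G)

-- shortest-path distance d(u,v): least k (searched up to V) with v in the k-ball of u.
-- (All graphs considered here are connected, so the search always succeeds.)
distFrom : Graph → ℕ → ℕ → ℕ → ℕ → ℕ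
distFrom G u v k zero = k
distFrom G u v k (suc fuel) =
  if v ∈ᵇ ball G k u then k else distFrom G u v (suc k) fuel

dist : Graph → ℕ → ℕ → ℕ
dist G u v = distFrom G u v 0 (V G)

count : {A : Set} → (A → Bool) → List A → ℕ
count p xs = length (filterᵇ p xs)

nVert : Graph → ℕ → ℕ → ℕ
nVert G u v = count (λ w → dist G w u <ᵇ dist G w v) (vertices G)

Mo : Graph → ℕ
Mo G = sum (map (λ e → ∣ nVert G (proj₁ e) (proj₂ e) - nVert G (proj₂ e) (proj₁ e) ∣) (E G))

distVE : Graph → ℕ → ℕ × ℕ → ℕ
distVE G w f = dist G w (proj₁ f) ⊓ dist G w (proj₂ f)

mEdge : Graph → ℕ → ℕ → ℕ
mEdge G u v = count (λ f → distVE G u f <ᵇ distVE G v f) (E G)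

Moₑ : Graph → ℕ
Moₑ G = sum (map (λ e → ∣ mEdge G (proj₁ e) (proj₂ e) - mEdge G (proj₂ e) (proj₁ e) ∣) (E G))

-- Cut vertices c_i = 3i (i = 0..n); square S_{i+1} (i = 0..n-1) is the 4-cycle
--   3i — 3i+1 — 3i+3 — 3i+2 — 3i,
-- so S_{i+1} and S_{i+2} share the vertex 3i+3, and the two shared vertices
-- 3i and 3i+3 of a middle square are opposite.

squareEdges : ℕ → List (ℕ × ℕ)
squareEdges i =
  (3 * i , 3 * i + 1) ∷ (3 * i + 1 , 3 * i + 3) ∷
  (3 * i + 3 , 3 * i + 2) ∷ (3 * i + 2 , 3 * i) ∷ []

Q : ℕ → Graph
Q n = mkGraph (3 * n + 1) (concatMap squareEdges (upTo n))

-- Square i of Q n is 3i — 3i+1 — 3i+3 — 3i+2, so every vertex x has a level ℓ(x) = d(0, x), and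
-- d(u, v) = |ℓ(u) − ℓ(v)| except that the two middle vertices of a square are at distance 2.  This
-- closed form is the breadth-first-search distance because it vanishes only at the source, grows by at
-- most one along an edge, and every positive value is one more than the value at some neighbour.
-- Every edge of square i joins consecutive levels.  A vertex or edge left of the cut vertex 3i (right
-- of 3i+3) is strictly closer to the lower (upper) endpoint, and inside square i exactly one vertex
-- and one edge is closer to each endpoint.  With t = n − 1 − i squares to the right, each edge of
-- square i therefore contributes |(3i+2) − (3t+2)| = 3|i − t| to Mo and |(4i+1) − (4t+1)| = 4|i − t|
-- to Moₑ, so Mo(Q n) = 12 T(n) and Moₑ(Q n) = 16 T(n) with T(n) = Σ_{i<n} |i − (n−1−i)|.  Finally
-- T(n+2) = T(n) + 2(n+1) gives T(2k) = 2k² and T(2k+1) = 2k² + 2k.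

module Submission where

open import Defs
open import Data.Bool using (Bool; true; false; T; _∧_; _∨_)
open import Data.Bool.Properties using (T-∧; T-∨)
open import Data.Bool.ListAction using (any)
open import Data.Empty using (⊥-elim)
open import Data.List using (List; []; _∷_; _++_; _∷ʳ_; map; length; concatMap; applyUpTo; upTo)
open import Data.List.Properties
  using (concatMap-++; length-applyUpTo; length-upTo; map-++; map-upTo; map-applyUpTo; applyUpTo-∷ʳ; map-cong-local)
open import Data.List.Relation.Unary.All as All using (All; []; _∷_)
import Data.List.Relation.Unary.All.Properties as Allₚ
open import Data.List.Relation.Unary.Any as Any using (Any; here; there)
open import Data.List.Relation.Unary.Any.Properties
  using (any⁺; any⁻; applyUpTo⁺; applyUpTo⁻; concat⁺; concat⁻; map⁺; map⁻)
open import Data.Nat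
open import Data.Nat.ListAction using (sum)
open import Data.Nat.ListAction.Properties using (sum-++)
open import Data.Nat.Properties
open import Data.Nat.Tactic.RingSolver using (solve-∀)
open import Data.Product using (_×_; _,_; ∃-syntax; proj₁; proj₂)
open import Data.Sum using (_⊎_; inj₁; inj₂)
open import Data.Unit using (tt)
open import Function using (_∘_; _∘′_; id; _⇔_; mk⇔; Equivalence)
open import Relation.Binary.PropositionalEquality
open import Relation.Nullary using (¬_; yes; no)

open Equivalence using (to; from)

filterᵇ⁻ : ∀ {A : Set} {P : A → Set} (b : A → Bool) xs →
           Any P (filterᵇ b xs) → Any (λ x → T (b x) × P x) xs
filterᵇ⁻ b (x ∷ xs) p with b x in eq
filterᵇ⁻ b (x ∷ xs) (here px) | true  = here (subst T (sym eq) tt , px)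
filterᵇ⁻ b (x ∷ xs) (there p) | true  = there (filterᵇ⁻ b xs p)
filterᵇ⁻ b (x ∷ xs) p         | false = there (filterᵇ⁻ b xs p)

filterᵇ⁺ : ∀ {A : Set} {P : A → Set} (b : A → Bool) xs →
           Any (λ x → T (b x) × P x) xs → Any P (filterᵇ b xs)
filterᵇ⁺ b (x ∷ xs) (here (bx , px)) with b x
... | true  = here px
filterᵇ⁺ b (x ∷ xs) (there p) with b x
... | true  = there (filterᵇ⁺ b xs p)
... | false = filterᵇ⁺ b xs p

applyUpTo-++ : ∀ {A : Set} (f : ℕ → A) m n → applyUpTo f (m + n) ≡ applyUpTo f m ++ applyUpTo (f ∘ (m +_)) n
applyUpTo-++ f zero    n = refl
applyUpTo-++ f (suc m) n = cong (f 0 ∷_) (applyUpTo-++ (f ∘ suc) m n)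

count-++ : ∀ {A : Set} (P : A → Bool) xs ys → count P (xs ++ ys) ≡ count P xs + count P ys
count-++ P []       ys = refl
count-++ P (x ∷ xs) ys with P x
... | true  = cong suc (count-++ P xs ys)
... | false = count-++ P xs ys

count-cong : ∀ {A : Set} {P R : A → Bool} {xs} → All (λ x → P x ≡ R x) xs → count P xs ≡ count R xs
count-cong {xs = []} [] = refl
count-cong {P = P} {R} {x ∷ xs} (Px≡Rx ∷ eqs) with P x | R x | Px≡Rx
... | true  | true  | refl = cong suc (count-cong eqs)
... | false | false | refl = count-cong eqs

count-map : ∀ {A B : Set} {P : B → Bool} {R : A → Bool} (f : A → B) →
            (∀ x → P (f x) ≡ R x) → ∀ xs → count P (map f xs) ≡ count R xs
count-map f P∘f≗R [] = refl
count-map {P = P} {R} f P∘f≗R (x ∷ xs) with P (f x) | R x | P∘f≗R x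
... | true  | true  | refl = cong suc (count-map f P∘f≗R xs)
... | false | false | refl = count-map f P∘f≗R xs

count-all : ∀ {A : Set} {P : A → Bool} {xs} → All (T ∘ P) xs → count P xs ≡ length xs
count-all {xs = []} [] = refl
count-all {P = P} {x ∷ xs} (px ∷ pxs) with P x | px
... | true | _ = cong suc (count-all pxs)

count-none : ∀ {A : Set} {P : A → Bool} {xs} → All (¬_ ∘ T ∘ P) xs → count P xs ≡ 0
count-none {xs = []} [] = refl
count-none {P = P} {x ∷ xs} (¬px ∷ ¬pxs) with P x | ¬px
... | true  | ¬⊤ = ⊥-elim (¬⊤ tt)
... | false | _  = count-none ¬pxs

Favours : ∀ {A : Set} → (A → Bool) → (A → Bool) → A → Set
Favours P R x = T (P x) × ¬ T (R x)

count-sandwich : ∀ {A : Set} {P R : A → Bool} xs ys zs → All (Favours P R) xs → All (Favours R P) zs →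
                 count P (xs ++ ys ++ zs) ≡ length xs + count P ys ×
                 count R (xs ++ ys ++ zs) ≡ count R ys + length zs
count-sandwich {P = P} {R} xs ys zs P-first R-last =
  trans (split P) (cong₂ _+_ (count-all (All.map proj₁ P-first))
                             (trans (cong (count P ys +_) (count-none (All.map proj₂ R-last))) (+-identityʳ _))) ,
  trans (split R) (cong₂ _+_ (count-none (All.map proj₂ P-first))
                             (cong (count R ys +_) (count-all (All.map proj₁ R-last))))
  where
  split : ∀ S → count S (xs ++ ys ++ zs) ≡ count S xs + (count S ys + count S zs)
  split S = trans (count-++ S xs (ys ++ zs)) (cong (count S xs +_) (count-++ S ys zs))

-- Breadth-first search

module BreadthFirstSearch
  (G : Graph) (u : ℕ) (δ : ℕ → ℕ)
  (u<V : u < V G)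
  (δ-source : δ u ≡ 0)
  (δ≡0⇒source : ∀ {x} → δ x ≡ 0 → x ≡ u)
  (δ-edge : ∀ {x y} → T (adj G x y) → δ y ≤ suc (δ x))
  (δ-parent : ∀ {y k} → y < V G → δ y ≡ suc k → ∃[ x ] x < V G × δ x ≡ k × T (adj G x y))
  where

  any-ball : ∀ k (f : ℕ → Bool) → T (any f (ball G k u)) ⇔ (∃[ x ] x < V G × δ x ≤ k × T (f x))
  any-ball zero f = mk⇔ forward backward
    where
    forward : T (any f (u ∷ [])) → ∃[ x ] x < V G × δ x ≤ 0 × T (f x)
    forward t with any⁻ f (u ∷ []) t
    ... | here fu = u , u<V , ≤-reflexive δ-source , fu
    backward : ∃[ x ] x < V G × δ x ≤ 0 × T (f x) → T (any f (u ∷ []))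
    backward (x , _ , δx≤0 , fx) with δ≡0⇒source (n≤0⇒n≡0 δx≤0)
    ... | refl = any⁺ {xs = x ∷ []} f (here fx)
  any-ball (suc k) f = mk⇔ forward backward
    where
    forward : T (any f (ball G (suc k) u)) → ∃[ x ] x < V G × δ x ≤ suc k × T (f x)
    forward t with applyUpTo⁻ id (filterᵇ⁻ _ (upTo (V G)) (any⁻ f (ball G (suc k) u) t))
    ... | x , x<V , reached , fx with to T-∨ reached
    ...   | inj₁ x∈ball with to (any-ball k (x ≡ᵇ_)) x∈ball
    ...     | y , _ , δy≤k , x≡y rewrite ≡ᵇ⇒≡ x y x≡y = y , x<V , m≤n⇒m≤1+n δy≤k , fx
    forward t | x , x<V , reached , fx | inj₂ x∼ball with to (any-ball k (λ y → adj G y x)) x∼ball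
    ...     | y , _ , δy≤k , y∼x = x , x<V , ≤-trans (δ-edge y∼x) (s≤s δy≤k) , fx
    backward : ∃[ x ] x < V G × δ x ≤ suc k × T (f x) → T (any f (ball G (suc k) u))
    backward (x , x<V , δx≤1+k , fx) = any⁺ f (filterᵇ⁺ _ _ (applyUpTo⁺ id (reached , fx) x<V))
      where
      reached : T ((x ∈ᵇ ball G k u) ∨ any (λ y → adj G y x) (ball G k u))
      reached with m≤n⇒m<n∨m≡n δx≤1+k
      ... | inj₁ δx≤k =
                from T-∨ (inj₁ (from (any-ball k (x ≡ᵇ_)) (x , x<V , ≤-pred δx≤k , ≡⇒≡ᵇ x x refl)))
      ... | inj₂ δx≡1+k with δ-parent x<V δx≡1+k
      ...   | y , y<V , δy≡k , y∼x =
                from T-∨ (inj₂ (from (any-ball k (λ y → adj G y x)) (y , y<V , ≤-reflexive δy≡k , y∼x)))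

  distFrom≡δ : ∀ {v} → v < V G → ∀ fuel k → k ≤ δ v → δ v ≤ k + fuel →
               distFrom G u v k fuel ≡ δ v
  distFrom≡δ {v} v<V zero k k≤δ δ≤k = ≤-antisym k≤δ (subst (δ v ≤_) (+-identityʳ k) δ≤k)
  distFrom≡δ {v} v<V (suc fuel) k k≤δ δ≤k+fuel with v ∈ᵇ ball G k u in found
  ... | true with to (any-ball k (v ≡ᵇ_)) (subst T (sym found) tt)
  ...   | w , _ , δw≤k , v≡w rewrite ≡ᵇ⇒≡ v w v≡w = ≤-antisym k≤δ δw≤k
  distFrom≡δ {v} v<V (suc fuel) k k≤δ δ≤k+fuel | false with δ v ≤? k
  ...   | yes δ≤k =
            ⊥-elim (subst T found (from (any-ball k (v ≡ᵇ_)) (v , v<V , δ≤k , ≡⇒≡ᵇ v v refl)))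
  ...   | no δ≰k = distFrom≡δ v<V fuel (suc k) (≰⇒> δ≰k) (subst (δ v ≤_) (+-suc k fuel) δ≤k+fuel)

  dist≡δ : ∀ {v} → v < V G → δ v ≤ V G → dist G u v ≡ δ v
  dist≡δ v<V δ≤V = distFrom≡δ v<V (V G) 0 z≤n δ≤V

m<n+1⇒m≤n : ∀ {m n} → m < n + 1 → m ≤ n
m<n+1⇒m≤n {m} {n} m<n+1 = m<1+n⇒m≤n (subst (m <_) (+-comm n 1) m<n+1)

∣n-1+n∣≡1 : ∀ n → ∣ n - suc n ∣ ≡ 1
∣n-1+n∣≡1 zero    = refl
∣n-1+n∣≡1 (suc n) = ∣n-1+n∣≡1 n

∣m-n∣≡1+∣m-1+n∣ : ∀ {m n} → n < m → ∣ m - n ∣ ≡ suc ∣ m - suc n ∣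
∣m-n∣≡1+∣m-1+n∣ {suc m} {zero}  _         = cong suc (sym (∣-∣-identityʳ m))
∣m-n∣≡1+∣m-1+n∣ {suc m} {suc n} (s≤s n<m) = ∣m-n∣≡1+∣m-1+n∣ n<m

∣m-n∣≡1⇒n≡1+m⊎m≡1+n : ∀ {m n} → ∣ m - n ∣ ≡ 1 → n ≡ suc m ⊎ m ≡ suc n
∣m-n∣≡1⇒n≡1+m⊎m≡1+n {zero}     {suc zero} _ = inj₁ refl
∣m-n∣≡1⇒n≡1+m⊎m≡1+n {suc zero} {zero}     _ = inj₂ refl
∣m-n∣≡1⇒n≡1+m⊎m≡1+n {suc m}    {suc n}    gap with ∣m-n∣≡1⇒n≡1+m⊎m≡1+n {m} {n} gap
... | inj₁ n≡1+m = inj₁ (cong suc n≡1+m)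
... | inj₂ m≡1+n = inj₂ (cong suc m≡1+n)

∣m-n∣≡2+k⇒between : ∀ {m n k} → ∣ m - n ∣ ≡ suc (suc k) →
                    ∃[ l ] ∣ m - l ∣ ≡ suc k × ∣ l - n ∣ ≡ 1 × l ≤ m ⊔ n
∣m-n∣≡2+k⇒between {zero}        {suc (suc k)} refl = suc k , refl , ∣n-1+n∣≡1 k , n≤1+n (suc k)
∣m-n∣≡2+k⇒between {suc (suc k)} {zero}        refl = 1 , refl , refl , s≤s z≤n
∣m-n∣≡2+k⇒between {suc m}       {suc n}       gap with ∣m-n∣≡2+k⇒between {m} {n} gap
... | l , gap-m , gap-n , l≤ = suc l , gap-m , gap-n , s≤s l≤

∣am+c-an+c∣≡a∣m-n∣ : ∀ a c m n → ∣ a * m + c - a * n + c ∣ ≡ a * ∣ m - n ∣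
∣am+c-an+c∣≡a∣m-n∣ a c m n = begin
  ∣ a * m + c - a * n + c ∣  ≡⟨ cong₂ ∣_-_∣ (+-comm (a * m) c) (+-comm (a * n) c) ⟩
  ∣ c + a * m - c + a * n ∣  ≡⟨ ∣m+n-m+o∣≡∣n-o∣ c (a * m) (a * n) ⟩
  ∣ a * m - a * n ∣          ≡⟨ *-distribˡ-∣-∣ a m n ⟨
  a * ∣ m - n ∣              ∎
  where open ≡-Reasoning

m∸n≡1+m∸[1+n] : ∀ {m n} → n < m → m ∸ n ≡ suc (m ∸ suc n)
m∸n≡1+m∸[1+n] {suc m} {zero}  _         = refl
m∸n≡1+m∸[1+n] {suc m} {suc n} (s≤s n<m) = m∸n≡1+m∸[1+n] n<m

-- level x = d(0, x): the cut vertex 3j has level 2j, the vertices 3j+1 and 3j+2 have level 2j+1.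
level : ℕ → ℕ
level 0 = 0
level 1 = 1
level 2 = 1
level (suc (suc (suc x))) = suc (suc (level x))

level-shift : ∀ j c → level (3 * j + c) ≡ 2 * j + level c
level-shift zero    c = refl
level-shift (suc j) c = begin
  level (3 * suc j + c)          ≡⟨ cong level (lemma₁ j c) ⟩
  suc (suc (level (3 * j + c)))  ≡⟨ cong (suc ∘′ suc) (level-shift j c) ⟩
  suc (suc (2 * j + level c))    ≡⟨ lemma₂ j (level c) ⟩
  2 * suc j + level c            ∎
  where
  open ≡-Reasoning
  lemma₁ : ∀ j c → 3 * suc j + c ≡ 3 + (3 * j + c)
  lemma₁ = solve-∀
  lemma₂ : ∀ j l → 2 + (2 * j + l) ≡ 2 * suc j + l
  lemma₂ = solve-∀

level-cut : ∀ j → level (3 * j) ≡ 2 * j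
level-cut j = begin
  level (3 * j)      ≡⟨ cong level (sym (+-identityʳ (3 * j))) ⟩
  level (3 * j + 0)  ≡⟨ level-shift j 0 ⟩
  2 * j + 0          ≡⟨ +-identityʳ (2 * j) ⟩
  2 * j              ∎
  where open ≡-Reasoning

level-side : ∀ j → level (3 * j + 1) ≡ suc (2 * j)
level-side j = trans (level-shift j 1) (+-comm (2 * j) 1)

level-gap-shift : ∀ j c c′ → ∣ level (3 * j + c) - level (3 * j + c′) ∣ ≡ ∣ level c - level c′ ∣
level-gap-shift j c c′ = trans (cong₂ ∣_-_∣ (level-shift j c) (level-shift j c′))
                               (∣m+n-m+o∣≡∣n-o∣ (2 * j) (level c) (level c′))

level-suc : ∀ x → level x ≤ level (suc x)
level-suc 0 = z≤n
level-suc 1 = ≤-refl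
level-suc 2 = s≤s z≤n
level-suc (suc (suc (suc x))) = s≤s (s≤s (level-suc x))

level-mono : ∀ {x y} → x ≤ y → level x ≤ level y
level-mono {x} x≤y with m≤n⇒∃[o]m+o≡n x≤y
... | o , refl = go x o
  where
  go : ∀ x o → level x ≤ level (x + o)
  go x zero    = ≤-reflexive (cong level (sym (+-identityʳ x)))
  go x (suc o) = ≤-trans (go x o) (subst (λ z → level (x + o) ≤ level z) (sym (+-suc x o)) (level-suc (x + o)))

level≡0⇒≡0 : ∀ {x} → level x ≡ 0 → x ≡ 0
level≡0⇒≡0 {0} _ = refl
level≡0⇒≡0 {1} ()
level≡0⇒≡0 {2} ()
level≡0⇒≡0 {suc (suc (suc _))} ()

<V⇒level≤ : ∀ {n x} → x < 3 * n + 1 → level x ≤ 2 * n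
<V⇒level≤ {n} {x} x<V = subst (level x ≤_) (level-cut n) (level-mono (m<n+1⇒m≤n x<V))

level≤⇒<V : ∀ {n x} → level x ≤ 2 * n → x < 3 * n + 1
level≤⇒<V {n} {x} level≤ with x <? 3 * n + 1
... | yes x<V = x<V
... | no  x≮V = ⊥-elim (<⇒≱ (s≤s level≤) (subst (_≤ level x) (level-side n) (level-mono (≮⇒≥ x≮V))))

level-below-cut : ∀ {w i} → w < 3 * i → level w < 2 * i
level-below-cut {w} {suc j} w<cut = begin-strict
  level w            ≤⟨ level-mono (≤-pred (subst (suc w ≤_) (lemma₁ j) w<cut)) ⟩
  level (3 * j + 2)  ≡⟨ trans (level-shift j 2) (+-comm (2 * j) 1) ⟩
  suc (2 * j)        <⟨ ≤-refl ⟩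
  suc (suc (2 * j))  ≡⟨ lemma₂ j ⟩
  2 * suc j          ∎
  where
  open ≤-Reasoning
  lemma₁ : ∀ j → 3 * suc j ≡ suc (3 * j + 2)
  lemma₁ = solve-∀
  lemma₂ : ∀ j → 2 + 2 * j ≡ 2 * suc j
  lemma₂ = solve-∀

cut-separates : ∀ {w u i} → w ≤ 3 * i → 3 * i ≤ u → level w < level u ⊎ w ≡ u
cut-separates {w} {u} {i} w≤cut cut≤u with m≤n⇒m<n∨m≡n w≤cut | m≤n⇒m<n∨m≡n cut≤u
... | inj₁ w<cut | _ =
  inj₁ (<-≤-trans (level-below-cut {w} {i} w<cut) (subst (_≤ level u) (level-cut i) (level-mono cut≤u)))
... | inj₂ refl | inj₂ refl = inj₂ refl
... | inj₂ refl | inj₁ cut<u =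
  inj₁ (<-≤-trans (subst (_< suc (2 * i)) (sym (level-cut i)) ≤-refl)
                  (subst (_≤ level u) (level-side i) (level-mono (subst (_≤ u) (+-comm 1 (3 * i)) cut<u))))

vertexAt : ℕ → ℕ
vertexAt 0 = 0
vertexAt 1 = 1
vertexAt (suc (suc l)) = 3 + vertexAt l

level-vertexAt : ∀ l → level (vertexAt l) ≡ l
level-vertexAt 0 = refl
level-vertexAt 1 = refl
level-vertexAt (suc (suc l)) = cong (suc ∘′ suc) (level-vertexAt l)

-- The distance in Q n

-- Two distinct vertices on the same level are the opposite corners 3j+1, 3j+2 of a square.
qdist : ℕ → ℕ → ℕ
qdist u v with u ≟ v | level u ≟ level v
... | yes _ | _     = 0
... | no  _ | yes _ = 2
... | no  _ | no  _ = ∣ level u - level v ∣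

data QDist (u v : ℕ) : ℕ → Set where
  same  : u ≡ v → QDist u v 0
  twins : u ≢ v → level u ≡ level v → QDist u v 2
  apart : level u ≢ level v → QDist u v ∣ level u - level v ∣

qdist-view : ∀ u v → QDist u v (qdist u v)
qdist-view u v with u ≟ v | level u ≟ level v
... | yes u≡v | _          = same u≡v
... | no  u≢v | yes same-l = twins u≢v same-l
... | no  _   | no  l≢l    = apart l≢l

qdist-same : ∀ {u v} → u ≡ v → qdist u v ≡ 0
qdist-same {u} {v} u≡v with qdist u v | qdist-view u v
... | _ | same _      = refl
... | _ | twins u≢v _ = ⊥-elim (u≢v u≡v)
... | _ | apart l≢l   = ⊥-elim (l≢l (cong level u≡v))

qdist-twins : ∀ {u v} → u ≢ v → level u ≡ level v → qdist u v ≡ 2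
qdist-twins {u} {v} u≢v same-l with qdist u v | qdist-view u v
... | _ | same u≡v  = ⊥-elim (u≢v u≡v)
... | _ | twins _ _ = refl
... | _ | apart l≢l = ⊥-elim (l≢l same-l)

qdist-apart : ∀ {u v} → level u ≢ level v → qdist u v ≡ ∣ level u - level v ∣
qdist-apart {u} {v} l≢l with qdist u v | qdist-view u v
... | _ | same u≡v       = ⊥-elim (l≢l (cong level u≡v))
... | _ | twins _ same-l = ⊥-elim (l≢l same-l)
... | _ | apart _        = refl

qdist-self : ∀ u → qdist u u ≡ 0
qdist-self u = qdist-same {u} refl

qdist≡0⇒≡ : ∀ {u v} → qdist u v ≡ 0 → u ≡ v
qdist≡0⇒≡ {u} {v} d≡0 with qdist u v | qdist-view u v
... | _ | same u≡v  = u≡v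
... | _ | apart l≢l = ⊥-elim (l≢l (∣m-n∣≡0⇒m≡n d≡0))

∣level∣≤qdist : ∀ u v → ∣ level u - level v ∣ ≤ qdist u v
∣level∣≤qdist u v with qdist u v | qdist-view u v
... | _ | same refl      = ≤-reflexive (∣n-n∣≡0 (level u))
... | _ | twins _ same-l = subst (_≤ 2) (sym (m≡n⇒∣m-n∣≡0 same-l)) z≤n
... | _ | apart _        = ≤-refl

qdist-sym : ∀ u v → qdist u v ≡ qdist v u
qdist-sym u v with qdist u v | qdist-view u v
... | _ | same u≡v         = sym (qdist-same (sym u≡v))
... | _ | twins u≢v same-l = sym (qdist-twins (u≢v ∘′ sym) (sym same-l))
... | _ | apart l≢l        = trans (∣-∣-comm (level u) (level v)) (sym (qdist-apart (l≢l ∘′ sym)))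

qdist-shift : ∀ j c c′ → qdist (3 * j + c) (3 * j + c′) ≡ qdist c c′
qdist-shift j c c′ with qdist c c′ | qdist-view c c′
... | _ | same refl = qdist-self (3 * j + c)
... | _ | twins c≢c′ same-l =
  qdist-twins (c≢c′ ∘′ +-cancelˡ-≡ (3 * j) c c′)
              (trans (level-shift j c) (trans (cong (2 * j +_) same-l) (sym (level-shift j c′))))
... | _ | apart l≢l = trans (qdist-apart shifted-apart) (level-gap-shift j c c′)
  where
  shifted-apart : level (3 * j + c) ≢ level (3 * j + c′)
  shifted-apart eq = l≢l (+-cancelˡ-≡ (2 * j) (level c) (level c′)
                       (trans (sym (level-shift j c)) (trans eq (level-shift j c′))))

qdist-through-lower : ∀ {lo hi w} → level hi ≡ suc (level lo) →
                      level w < level lo ⊎ w ≡ lo → qdist w hi ≡ suc (qdist w lo)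
qdist-through-lower {lo} {hi} rises (inj₂ refl) = begin
  qdist lo hi                   ≡⟨ qdist-apart (λ eq → 1+n≢n (sym (trans eq rises))) ⟩
  ∣ level lo - level hi ∣       ≡⟨ cong (∣ level lo -_∣) rises ⟩
  ∣ level lo - suc (level lo) ∣ ≡⟨ ∣n-1+n∣≡1 (level lo) ⟩
  1                             ≡⟨ cong suc (sym (qdist-self lo)) ⟩
  suc (qdist lo lo)             ∎
  where open ≡-Reasoning
qdist-through-lower {lo} {hi} {w} rises (inj₁ below) = begin
  qdist w hi                       ≡⟨ qdist-apart (<⇒≢ w<hi) ⟩
  ∣ level w - level hi ∣           ≡⟨ ∣-∣-comm (level w) (level hi) ⟩
  ∣ level hi - level w ∣           ≡⟨ ∣m-n∣≡1+∣m-1+n∣ w<hi ⟩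
  suc ∣ level hi - suc (level w) ∣ ≡⟨ cong (λ l → suc ∣ l - suc (level w) ∣) rises ⟩
  suc ∣ level lo - level w ∣       ≡⟨ cong suc (∣-∣-comm (level lo) (level w)) ⟩
  suc ∣ level w - level lo ∣       ≡⟨ cong suc (sym (qdist-apart (<⇒≢ below))) ⟩
  suc (qdist w lo)                 ∎
  where
  open ≡-Reasoning
  w<hi : level w < level hi
  w<hi = <-trans below (subst (level lo <_) (sym rises) ≤-refl)

qdist-through-upper : ∀ {lo hi w} → level hi ≡ suc (level lo) →
                      level hi < level w ⊎ w ≡ hi → qdist w lo ≡ suc (qdist w hi)
qdist-through-upper {lo} {hi} rises (inj₂ refl) = begin
  qdist hi lo                   ≡⟨ qdist-apart (λ eq → 1+n≢n (trans (sym rises) eq)) ⟩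
  ∣ level hi - level lo ∣       ≡⟨ cong (∣_- level lo ∣) rises ⟩
  ∣ suc (level lo) - level lo ∣ ≡⟨ ∣-∣-comm (suc (level lo)) (level lo) ⟩
  ∣ level lo - suc (level lo) ∣ ≡⟨ ∣n-1+n∣≡1 (level lo) ⟩
  1                             ≡⟨ cong suc (sym (qdist-self hi)) ⟩
  suc (qdist hi hi)             ∎
  where open ≡-Reasoning
qdist-through-upper {lo} {hi} {w} rises (inj₁ above) = begin
  qdist w lo                       ≡⟨ qdist-apart (≢-sym (<⇒≢ lo<w)) ⟩
  ∣ level w - level lo ∣           ≡⟨ ∣m-n∣≡1+∣m-1+n∣ lo<w ⟩
  suc ∣ level w - suc (level lo) ∣ ≡⟨ cong (λ l → suc ∣ level w - l ∣) (sym rises) ⟩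
  suc ∣ level w - level hi ∣       ≡⟨ cong suc (sym (qdist-apart (≢-sym (<⇒≢ above)))) ⟩
  suc (qdist w hi)                 ∎
  where
  open ≡-Reasoning
  lo<w : level lo < level w
  lo<w = <-trans (subst (level lo <_) (sym rises) ≤-refl) above

qdist≤V : ∀ {n u v} → u < 3 * n + 1 → v < 3 * n + 1 → qdist u v ≤ 3 * n + 1
qdist≤V {n} {u} {v} u<V v<V with qdist u v | qdist-view u v
... | _ | same _ = z≤n
... | _ | apart _ = begin
  ∣ level u - level v ∣  ≤⟨ ∣m-n∣≤m⊔n (level u) (level v) ⟩
  level u ⊔ level v      ≤⟨ ⊔-lub (<V⇒level≤ {n} u<V) (<V⇒level≤ {n} v<V) ⟩
  2 * n                  ≤⟨ *-monoˡ-≤ n {2} {3} (s≤s (s≤s z≤n)) ⟩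
  3 * n                  ≤⟨ m≤m+n (3 * n) 1 ⟩
  3 * n + 1              ∎
  where open ≤-Reasoning
... | _ | twins u≢v _ with n
...   | zero = ⊥-elim (u≢v (trans (n<1⇒n≡0 u<V) (sym (n<1⇒n≡0 v<V))))
...   | suc m = subst (2 ≤_) (lemma m) (m≤m+n 2 (3 * m + 2))
  where
  lemma : ∀ m → 2 + (3 * m + 2) ≡ 3 * suc m + 1
  lemma = solve-∀

Joins : ℕ → ℕ → ℕ × ℕ → Set
Joins x y e = e ≡ (x , y) ⊎ e ≡ (y , x)

Joins-sym : ∀ {x y e} → Joins x y e → Joins y x e
Joins-sym (inj₁ e≡xy) = inj₂ e≡xy
Joins-sym (inj₂ e≡yx) = inj₁ e≡yx

adj⇔Any-Joins : ∀ G {x y} → T (adj G x y) ⇔ Any (Joins x y) (E G)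
adj⇔Any-Joins G {x} {y} =
  mk⇔ (Any.map (λ {e} → joins e) ∘ any⁻ matches (E G)) (any⁺ matches ∘ Any.map (λ {e} → joined e))
  where
  matches : ℕ × ℕ → Bool
  matches e = ((proj₁ e ≡ᵇ x) ∧ (proj₂ e ≡ᵇ y)) ∨ ((proj₁ e ≡ᵇ y) ∧ (proj₂ e ≡ᵇ x))
  joins : ∀ e → T (matches e) → Joins x y e
  joins (a , b) t with to T-∨ t
  ... | inj₁ t′ with to T-∧ t′
  ...   | a≡x , b≡y rewrite ≡ᵇ⇒≡ a x a≡x | ≡ᵇ⇒≡ b y b≡y = inj₁ refl
  joins (a , b) t | inj₂ t′ with to T-∧ t′
  ...   | a≡y , b≡x rewrite ≡ᵇ⇒≡ a y a≡y | ≡ᵇ⇒≡ b x b≡x = inj₂ refl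
  joined : ∀ e → Joins x y e → T (matches e)
  joined _ (inj₁ refl) = from T-∨ (inj₁ (from T-∧ (≡⇒≡ᵇ x x refl , ≡⇒≡ᵇ y y refl)))
  joined _ (inj₂ refl) = from T-∨ (inj₂ (from T-∧ (≡⇒≡ᵇ y y refl , ≡⇒≡ᵇ x x refl)))

Any-E-Q : ∀ {n} {P : ℕ × ℕ → Set} → Any P (E (Q n)) ⇔ (∃[ i ] i < n × Any P (squareEdges i))
Any-E-Q {n} =
  mk⇔ (applyUpTo⁻ id ∘ map⁻ ∘ concat⁻ _) (λ (i , i<n , p) → concat⁺ (map⁺ (applyUpTo⁺ id p i<n)))

shift : ℕ → ℕ × ℕ → ℕ × ℕ
shift d (a , b) = (d + a , d + b)

squareEdges-+ : ∀ j k → squareEdges (j + k) ≡ map (shift (3 * j)) (squareEdges k)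
squareEdges-+ j k
  rewrite *-distribˡ-+ 3 j k
        | +-assoc (3 * j) (3 * k) 1 | +-assoc (3 * j) (3 * k) 2 | +-assoc (3 * j) (3 * k) 3 = refl

squareEdges-translate : ∀ j → squareEdges j ≡ map (shift (3 * j)) (squareEdges 0)
squareEdges-translate j = trans (cong squareEdges (sym (+-identityʳ j))) (squareEdges-+ j 0)

adj⇒level-gap : ∀ {n x y} → T (adj (Q n) x y) → ∣ level x - level y ∣ ≡ 1
adj⇒level-gap {n} {x} {y} x∼y with to (Any-E-Q {n}) (to (adj⇔Any-Joins (Q n)) x∼y)
... | i , _ , joins = base (map⁻ (subst (Any (Joins x y)) (squareEdges-translate i) joins))
  where
  base : Any (Joins x y ∘ shift (3 * i)) (squareEdges 0) → ∣ level x - level y ∣ ≡ 1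
  base (here (inj₁ refl)) = level-gap-shift i 0 1
  base (here (inj₂ refl)) = level-gap-shift i 1 0
  base (there (here (inj₁ refl))) = level-gap-shift i 1 3
  base (there (here (inj₂ refl))) = level-gap-shift i 3 1
  base (there (there (here (inj₁ refl)))) = level-gap-shift i 3 2
  base (there (there (here (inj₂ refl)))) = level-gap-shift i 2 3
  base (there (there (there (here (inj₁ refl))))) = level-gap-shift i 2 0
  base (there (there (there (here (inj₂ refl))))) = level-gap-shift i 0 2

rising⇒square : ∀ x y → level y ≡ suc (level x) → ∃[ j ] 3 * j < y × Any (Joins x y) (squareEdges j)
rising⇒square 0 1 _ = 0 , s≤s z≤n , here (inj₁ refl)
rising⇒square 0 2 _ = 0 , s≤s z≤n , there (there (there (here (inj₂ refl))))
rising⇒square 0 (suc (suc (suc _))) ()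
rising⇒square 1 3 _ = 0 , s≤s z≤n , there (here (inj₁ refl))
rising⇒square 1 4 ()
rising⇒square 1 5 ()
rising⇒square 1 (suc (suc (suc (suc (suc (suc _)))))) ()
rising⇒square 2 3 _ = 0 , s≤s z≤n , there (there (here (inj₂ refl)))
rising⇒square 2 4 ()
rising⇒square 2 5 ()
rising⇒square 2 (suc (suc (suc (suc (suc (suc _)))))) ()
rising⇒square (suc (suc (suc x))) (suc (suc (suc y))) rises
  with rising⇒square x y (suc-injective (suc-injective rises))
... | j , 3j<y , joins = suc j , subst (_< 3 + y) (lemma j) (+-monoʳ-< 3 3j<y) ,
                         subst (Any (Joins (3 + x) (3 + y))) (sym (squareEdges-+ 1 j)) (map⁺ (Any.map shifted joins))
  where
  lemma : ∀ j → 3 + 3 * j ≡ 3 * suc j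
  lemma = solve-∀
  shifted : ∀ {e} → Joins x y e → Joins (3 + x) (3 + y) (shift 3 e)
  shifted (inj₁ refl) = inj₁ refl
  shifted (inj₂ refl) = inj₂ refl

level-gap⇒adj : ∀ {n x y} → x < 3 * n + 1 → y < 3 * n + 1 →
                ∣ level x - level y ∣ ≡ 1 → T (adj (Q n) x y)
level-gap⇒adj {n} {x} {y} x<V y<V gap =
  from (adj⇔Any-Joins (Q n)) (from (Any-E-Q {n}) (edge (∣m-n∣≡1⇒n≡1+m⊎m≡1+n gap)))
  where
  inQ : ∀ {j z} → 3 * j < z → z < 3 * n + 1 → j < n
  inQ {j} 3j<z z<V = *-cancelˡ-< 3 j n (<-≤-trans 3j<z (m<n+1⇒m≤n z<V))
  edge : level y ≡ suc (level x) ⊎ level x ≡ suc (level y) → ∃[ i ] i < n × Any (Joins x y) (squareEdges i)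
  edge (inj₁ rises) with rising⇒square x y rises
  ... | j , 3j<y , joins = j , inQ 3j<y y<V , joins
  edge (inj₂ falls) with rising⇒square y x falls
  ... | j , 3j<x , joins = j , inQ 3j<x x<V , Any.map Joins-sym joins

qdist-edge : ∀ {n u x y} → T (adj (Q n) x y) → qdist u y ≤ suc (qdist u x)
qdist-edge {n} {u} {x} {y} x∼y with qdist u y | qdist-view u y
... | _ | same _ = z≤n
... | _ | twins _ same-l = s≤s (subst (1 ≤_) gap-u-x≡qdist (≤-reflexive (sym gap-u-x)))
  where
  gap-u-x : ∣ level u - level x ∣ ≡ 1
  gap-u-x = trans (cong (∣_- level x ∣) same-l)
                  (trans (∣-∣-comm (level y) (level x)) (adj⇒level-gap {n} x∼y))
  gap-u-x≡qdist : ∣ level u - level x ∣ ≡ qdist u x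
  gap-u-x≡qdist = sym (qdist-apart {u} {x} (λ eq → 0≢1+n (trans (sym (m≡n⇒∣m-n∣≡0 eq)) gap-u-x)))
... | _ | apart _ = begin
  ∣ level u - level y ∣                         ≤⟨ ∣-∣-triangle (level u) (level x) (level y) ⟩
  ∣ level u - level x ∣ + ∣ level x - level y ∣ ≡⟨ cong (_ +_) (adj⇒level-gap {n} x∼y) ⟩
  ∣ level u - level x ∣ + 1                     ≤⟨ +-monoˡ-≤ 1 (∣level∣≤qdist u x) ⟩
  qdist u x + 1                                 ≡⟨ +-comm (qdist u x) 1 ⟩
  suc (qdist u x)                               ∎
  where open ≤-Reasoning

parent-at-level : ∀ {n u y k} l → ∣ level u - l ∣ ≡ suc k → ∣ l - level y ∣ ≡ 1 →
                  l ≤ 2 * n → y < 3 * n + 1 →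
                  ∃[ x ] x < 3 * n + 1 × qdist u x ≡ suc k × T (adj (Q n) x y)
parent-at-level {n} {u} {y} l gap-u gap-y l≤2n y<V =
  vertexAt l , x<V , trans (qdist-apart {u} {vertexAt l} u≢x) gap-u′ ,
  level-gap⇒adj {n} x<V y<V (subst (λ m → ∣ m - level y ∣ ≡ 1) (sym (level-vertexAt l)) gap-y)
  where
  x<V : vertexAt l < 3 * n + 1
  x<V = level≤⇒<V {n} (subst (_≤ 2 * n) (sym (level-vertexAt l)) l≤2n)
  gap-u′ : ∣ level u - level (vertexAt l) ∣ ≡ suc _
  gap-u′ = trans (cong (∣ level u -_∣) (level-vertexAt l)) gap-u
  u≢x : level u ≢ level (vertexAt l)
  u≢x eq = 0≢1+n (trans (sym (m≡n⇒∣m-n∣≡0 eq)) gap-u′)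

qdist-parent : ∀ {n u y k} → u < 3 * n + 1 → y < 3 * n + 1 → qdist u y ≡ suc k →
               ∃[ x ] x < 3 * n + 1 × qdist u x ≡ k × T (adj (Q n) x y)
qdist-parent {n} {u} {y} {k} u<V y<V d≡1+k with qdist u y | qdist-view u y
... | _ | same _ = ⊥-elim (0≢1+n d≡1+k)
... | _ | twins u≢y same-l with d≡1+k | level y in level-y
...   | refl | zero = ⊥-elim (u≢y (trans (level≡0⇒≡0 same-l) (sym (level≡0⇒≡0 level-y))))
...   | refl | suc l = parent-at-level {n} {u} {y} l gap-u (trans (cong (∣ l -_∣) level-y) (∣n-1+n∣≡1 l))
                         (≤-trans (n≤1+n l) (subst (_≤ 2 * n) level-y (<V⇒level≤ {n} y<V))) y<V
  where
  gap-u : ∣ level u - l ∣ ≡ 1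
  gap-u = trans (cong (∣_- l ∣) same-l) (trans (∣-∣-comm (suc l) l) (∣n-1+n∣≡1 l))
qdist-parent {n} {u} {y} {zero} u<V y<V d≡1 | _ | apart _ = u , u<V , qdist-self u , level-gap⇒adj {n} u<V y<V d≡1
qdist-parent {n} {u} {y} {suc k} u<V y<V d≡2+k | _ | apart _ with ∣m-n∣≡2+k⇒between d≡2+k
... | l , gap-u , gap-y , l≤ =
  parent-at-level {n} {u} {y} l gap-u gap-y
                  (≤-trans l≤ (⊔-lub (<V⇒level≤ {n} u<V) (<V⇒level≤ {n} y<V))) y<V

Q-dist : ∀ {n u v} → u < 3 * n + 1 → v < 3 * n + 1 → dist (Q n) u v ≡ qdist u v
Q-dist {n} {u} u<V v<V = dist≡δ v<V (qdist≤V {n} u<V v<V)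
  where
  open BreadthFirstSearch (Q n) u (qdist u) u<V (qdist-self u) (sym ∘ qdist≡0⇒≡ {u})
                          (qdist-edge {n} {u}) (qdist-parent {n} {u} u<V)

-- Counting closer vertices and edges

closerᵛ : ℕ → ℕ → ℕ → Bool
closerᵛ a b w = qdist w a <ᵇ qdist w b

closerᵉ : ℕ → ℕ → ℕ × ℕ → Bool
closerᵉ a b e = (qdist (proj₁ e) a ⊓ qdist (proj₂ e) a) <ᵇ (qdist (proj₁ e) b ⊓ qdist (proj₂ e) b)

closer-step : ∀ {x y} → y ≡ suc x → T (x <ᵇ y) × ¬ T (y <ᵇ x)
closer-step {x} refl = <⇒<ᵇ (n<1+n x) , λ t → <-asym (<ᵇ⇒< _ _ t) (n<1+n x)

closerᵛ-shift : ∀ i a b w → closerᵛ (3 * i + a) (3 * i + b) (3 * i + w) ≡ closerᵛ a b w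
closerᵛ-shift i a b w = cong₂ _<ᵇ_ (qdist-shift i w a) (qdist-shift i w b)

closerᵉ-shift : ∀ i a b e → closerᵉ (3 * i + a) (3 * i + b) (shift (3 * i) e) ≡ closerᵉ a b e
closerᵉ-shift i a b (x , y) = cong₂ _<ᵇ_ (cong₂ _⊓_ (qdist-shift i x a) (qdist-shift i y a))
                                         (cong₂ _⊓_ (qdist-shift i x b) (qdist-shift i y b))

Within : ℕ → ℕ → Set
Within j x = 3 * j ≤ x × x ≤ 3 * j + 3

squareEdges-within : ∀ j → All (λ e → Within j (proj₁ e) × Within j (proj₂ e)) (squareEdges j)
squareEdges-within j =
  subst (All _) (sym (squareEdges-translate j))
        (Allₚ.map⁺ (All.map (λ (c≤3 , c′≤3) → within c≤3 , within c′≤3) base))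
  where
  within : ∀ {c} → c ≤ 3 → Within j (3 * j + c)
  within {c} c≤3 = m≤m+n (3 * j) c , +-monoʳ-≤ (3 * j) c≤3
  base : All (λ e → proj₁ e ≤ 3 × proj₂ e ≤ 3) (squareEdges 0)
  base = (z≤n , s≤s z≤n) ∷ (s≤s z≤n , ≤-refl) ∷
         (≤-refl , s≤s (s≤s z≤n)) ∷ (s≤s (s≤s z≤n) , z≤n) ∷ []

All-squares : ∀ {P : ℕ → Set} f m → (∀ {j x} → j < m → Within (f j) x → P x) →
              All (λ e → P (proj₁ e) × P (proj₂ e)) (concatMap squareEdges (applyUpTo f m))
All-squares f m within⇒P = Allₚ.concat⁺ (Allₚ.map⁺ (Allₚ.applyUpTo⁺₁ f m (λ {j} j<m →
  All.map (λ (x∈ , y∈) → within⇒P j<m x∈ , within⇒P j<m y∈) (squareEdges-within (f j)))))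

length-concatMap-squareEdges : ∀ xs → length (concatMap squareEdges xs) ≡ 4 * length xs
length-concatMap-squareEdges []       = refl
length-concatMap-squareEdges (x ∷ xs) = trans (cong (4 +_) (length-concatMap-squareEdges xs)) (lemma (length xs))
  where
  lemma : ∀ m → 4 + 4 * m ≡ 4 * suc m
  lemma = solve-∀

vertex-in-range : ∀ {n i x} → i < n → x ≤ 3 * i + 3 → x < 3 * n + 1
vertex-in-range {n} {i} {x} i<n x≤ =
  subst (suc x ≤_) (+-comm 1 (3 * n)) (s≤s (≤-trans x≤ (subst (_≤ 3 * n) (lemma i) (*-monoʳ-≤ 3 i<n))))
  where
  lemma : ∀ i → 3 * suc i ≡ 3 * i + 3
  lemma = solve-∀

nVert-Q : ∀ {n u v} → u < 3 * n + 1 → v < 3 * n + 1 →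
          nVert (Q n) u v ≡ count (closerᵛ u v) (upTo (3 * n + 1))
nVert-Q {n} u<V v<V = count-cong (All.map (λ w<V → cong₂ _<ᵇ_ (Q-dist {n} w<V u<V) (Q-dist {n} w<V v<V))
                                          (Allₚ.all-upTo (3 * n + 1)))

mEdge-Q : ∀ {n u v} → u < 3 * n + 1 → v < 3 * n + 1 → mEdge (Q n) u v ≡ count (closerᵉ u v) (E (Q n))
mEdge-Q {n} {u} {v} u<V v<V =
  count-cong (All.map dist≡ (All-squares id n (λ j<n (_ , x≤) → vertex-in-range j<n x≤)))
  where
  dist≡ : ∀ {e} → proj₁ e < 3 * n + 1 × proj₂ e < 3 * n + 1 →
          (distVE (Q n) u e <ᵇ distVE (Q n) v e) ≡ closerᵉ u v e
  dist≡ {x , y} (x<V , y<V) =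
    cong₂ _<ᵇ_ (cong₂ _⊓_ (from-edge u<V x<V) (from-edge u<V y<V)) (cong₂ _⊓_ (from-edge v<V x<V) (from-edge v<V y<V))
    where
    from-edge : ∀ {a b} → a < 3 * n + 1 → b < 3 * n + 1 → dist (Q n) a b ≡ qdist b a
    from-edge {a} {b} a<V b<V = trans (Q-dist {n} a<V b<V) (qdist-sym a b)

-- The edges of the first square, oriented towards the higher level; the edges of square i
-- are their translates by 3 * i.
data BaseRise : ℕ → ℕ → Set where
  0↗1 : BaseRise 0 1
  0↗2 : BaseRise 0 2
  1↗3 : BaseRise 1 3
  2↗3 : BaseRise 2 3

rise-bottom : ∀ {c c′} → BaseRise c c′ → c ≤ 3
rise-bottom 0↗1 = z≤n
rise-bottom 0↗2 = z≤n
rise-bottom 1↗3 = s≤s z≤n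
rise-bottom 2↗3 = s≤s (s≤s z≤n)

rise-top : ∀ {c c′} → BaseRise c c′ → c′ ≤ 3
rise-top 0↗1 = s≤s z≤n
rise-top 0↗2 = s≤s (s≤s z≤n)
rise-top 1↗3 = ≤-refl
rise-top 2↗3 = ≤-refl

rise-middle-vertices : ∀ {c c′} → BaseRise c c′ →
                       count (closerᵛ c c′) (1 ∷ 2 ∷ []) ≡ 1 ×
                       count (closerᵛ c′ c) (1 ∷ 2 ∷ []) ≡ 1
rise-middle-vertices 0↗1 = refl , refl
rise-middle-vertices 0↗2 = refl , refl
rise-middle-vertices 1↗3 = refl , refl
rise-middle-vertices 2↗3 = refl , refl

rise-middle-edges : ∀ {c c′} → BaseRise c c′ →
                    count (closerᵉ c c′) (squareEdges 0) ≡ 1 × count (closerᵉ c′ c) (squareEdges 0) ≡ 1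
rise-middle-edges 0↗1 = refl , refl
rise-middle-edges 0↗2 = refl , refl
rise-middle-edges 1↗3 = refl , refl
rise-middle-edges 2↗3 = refl , refl

rise-level : ∀ {c c′} → BaseRise c c′ → ∀ i → level (3 * i + c′) ≡ suc (level (3 * i + c))
rise-level {c} {c′} r i = begin
  level (3 * i + c′)        ≡⟨ level-shift i c′ ⟩
  2 * i + level c′          ≡⟨ cong (2 * i +_) (base r) ⟩
  2 * i + suc (level c)     ≡⟨ +-suc (2 * i) (level c) ⟩
  suc (2 * i + level c)     ≡⟨ cong suc (sym (level-shift i c)) ⟩
  suc (level (3 * i + c))   ∎
  where
  open ≡-Reasoning
  base : ∀ {c c′} → BaseRise c c′ → level c′ ≡ suc (level c)
  base 0↗1 = refl
  base 0↗2 = refl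
  base 1↗3 = refl
  base 2↗3 = refl

rise-in-range : ∀ {c c′ i n} → BaseRise c c′ → i < n → 3 * i + c < 3 * n + 1 × 3 * i + c′ < 3 * n + 1
rise-in-range {i = i} r i<n = vertex-in-range i<n (+-monoʳ-≤ (3 * i) (rise-bottom r)) ,
                              vertex-in-range i<n (+-monoʳ-≤ (3 * i) (rise-top r))

rise-below : ∀ {c c′ i w} → BaseRise c c′ → w ≤ 3 * i →
             qdist w (3 * i + c′) ≡ suc (qdist w (3 * i + c))
rise-below {c} {i = i} {w} r w≤cut =
  qdist-through-lower (rise-level r i) (cut-separates {w} {3 * i + c} {i} w≤cut (m≤m+n (3 * i) c))

rise-above : ∀ {c c′ i w} → BaseRise c c′ → 3 * suc i ≤ w →
             qdist w (3 * i + c) ≡ suc (qdist w (3 * i + c′))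
rise-above {c} {c′} {i} {w} r cut≤w = qdist-through-upper (rise-level r i) above
  where
  lemma : ∀ i → 3 * i + 3 ≡ 3 * suc i
  lemma = solve-∀
  hi≤cut : 3 * i + c′ ≤ 3 * suc i
  hi≤cut = subst (3 * i + c′ ≤_) (lemma i) (+-monoʳ-≤ (3 * i) (rise-top r))
  above : level (3 * i + c′) < level w ⊎ w ≡ 3 * i + c′
  above with cut-separates {3 * i + c′} {w} {suc i} hi≤cut cut≤w
  ... | inj₁ lt = inj₁ lt
  ... | inj₂ eq = inj₂ (sym eq)

vertices-split : ∀ i t → upTo (3 * (i + suc t) + 1) ≡
                 upTo (3 * i + 1) ++ map (3 * i +_) (1 ∷ 2 ∷ []) ++
                 applyUpTo (λ j → 3 * i + 1 + suc (suc j)) (3 * t + 1)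
vertices-split i t = trans (cong upTo (lemma i t)) (trans (applyUpTo-++ id (3 * i + 1) (2 + (3 * t + 1)))
  (cong (upTo (3 * i + 1) ++_) (cong₂ _∷_ (+-identityʳ (3 * i + 1)) (cong (_∷ right) (+-assoc (3 * i) 1 1)))))
  where
  right : List ℕ
  right = applyUpTo (λ j → 3 * i + 1 + suc (suc j)) (3 * t + 1)
  lemma : ∀ i t → 3 * (i + suc t) + 1 ≡ (3 * i + 1) + (2 + (3 * t + 1))
  lemma = solve-∀

edges-split : ∀ i t → E (Q (i + suc t)) ≡
              concatMap squareEdges (upTo i) ++ map (shift (3 * i)) (squareEdges 0) ++
              concatMap squareEdges (applyUpTo (λ j → i + suc j) t)
edges-split i t = trans (cong (concatMap squareEdges) (applyUpTo-++ id i (suc t)))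
  (trans (concatMap-++ squareEdges (upTo i) (applyUpTo (i +_) (suc t)))
         (cong (λ es → concatMap squareEdges (upTo i) ++ es ++ right) (squareEdges-+ i 0)))
  where
  right : List (ℕ × ℕ)
  right = concatMap squareEdges (applyUpTo (λ j → i + suc j) t)

nVert-rise : ∀ {i t c c′} → BaseRise c c′ →
             nVert (Q (i + suc t)) (3 * i + c) (3 * i + c′) ≡ 3 * i + 2 ×
             nVert (Q (i + suc t)) (3 * i + c′) (3 * i + c) ≡ 3 * t + 2
nVert-rise {i} {t} {c} {c′} r = towards-lo , towards-hi
  where
  open ≡-Reasoning
  n lo hi : ℕ
  n = i + suc t
  lo = 3 * i + c
  hi = 3 * i + c′
  left mid right : List ℕ
  left = upTo (3 * i + 1)
  mid = map (3 * i +_) (1 ∷ 2 ∷ [])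
  right = applyUpTo (λ j → 3 * i + 1 + suc (suc j)) (3 * t + 1)
  lemma : ∀ i j → 3 * suc i + j ≡ 3 * i + 1 + suc (suc j)
  lemma = solve-∀
  sandwich : count (closerᵛ lo hi) (left ++ mid ++ right) ≡ length left + count (closerᵛ lo hi) mid ×
             count (closerᵛ hi lo) (left ++ mid ++ right) ≡ count (closerᵛ hi lo) mid + length right
  sandwich = count-sandwich left mid right
    (Allₚ.applyUpTo⁺₁ id (3 * i + 1) (λ w<cut → closer-step (rise-below {i = i} r (m<n+1⇒m≤n w<cut))))
    (Allₚ.applyUpTo⁺₂ _ (3 * t + 1)
      (λ j → closer-step (rise-above {i = i} r (subst (3 * suc i ≤_) (lemma i j) (m≤m+n _ j)))))
  in-range : lo < 3 * n + 1 × hi < 3 * n + 1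
  in-range = rise-in-range {i = i} {n} r (m<m+n i z<s)
  mid-lo : count (closerᵛ lo hi) mid ≡ 1
  mid-lo = trans (count-map {P = closerᵛ lo hi} (3 * i +_) (closerᵛ-shift i c c′) (1 ∷ 2 ∷ []))
                 (proj₁ (rise-middle-vertices r))
  mid-hi : count (closerᵛ hi lo) mid ≡ 1
  mid-hi = trans (count-map {P = closerᵛ hi lo} (3 * i +_) (closerᵛ-shift i c′ c) (1 ∷ 2 ∷ []))
                 (proj₂ (rise-middle-vertices r))
  towards-lo : nVert (Q n) lo hi ≡ 3 * i + 2
  towards-lo = begin
    nVert (Q n) lo hi                             ≡⟨ nVert-Q {n} (proj₁ in-range) (proj₂ in-range) ⟩
    count (closerᵛ lo hi) (upTo (3 * n + 1))      ≡⟨ cong (count (closerᵛ lo hi)) (vertices-split i t) ⟩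
    count (closerᵛ lo hi) (left ++ mid ++ right)  ≡⟨ proj₁ sandwich ⟩
    length left + count (closerᵛ lo hi) mid       ≡⟨ cong₂ _+_ (length-upTo (3 * i + 1)) mid-lo ⟩
    3 * i + 1 + 1                                 ≡⟨ +-assoc (3 * i) 1 1 ⟩
    3 * i + 2                                     ∎
  towards-hi : nVert (Q n) hi lo ≡ 3 * t + 2
  towards-hi = begin
    nVert (Q n) hi lo                             ≡⟨ nVert-Q {n} (proj₂ in-range) (proj₁ in-range) ⟩
    count (closerᵛ hi lo) (upTo (3 * n + 1))      ≡⟨ cong (count (closerᵛ hi lo)) (vertices-split i t) ⟩
    count (closerᵛ hi lo) (left ++ mid ++ right)  ≡⟨ proj₂ sandwich ⟩
    count (closerᵛ hi lo) mid + length right      ≡⟨ cong₂ _+_ mid-hi (length-applyUpTo _ (3 * t + 1)) ⟩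
    1 + (3 * t + 1)                               ≡⟨ trans (+-comm 1 (3 * t + 1)) (+-assoc (3 * t) 1 1) ⟩
    3 * t + 2                                     ∎

mEdge-rise : ∀ {i t c c′} → BaseRise c c′ →
             mEdge (Q (i + suc t)) (3 * i + c) (3 * i + c′) ≡ 4 * i + 1 ×
             mEdge (Q (i + suc t)) (3 * i + c′) (3 * i + c) ≡ 4 * t + 1
mEdge-rise {i} {t} {c} {c′} r = towards-lo , towards-hi
  where
  open ≡-Reasoning
  n lo hi : ℕ
  n = i + suc t
  lo = 3 * i + c
  hi = 3 * i + c′
  left mid right : List (ℕ × ℕ)
  left = concatMap squareEdges (upTo i)
  mid = map (shift (3 * i)) (squareEdges 0)
  right = concatMap squareEdges (applyUpTo (λ j → i + suc j) t)
  lemma : ∀ j → 3 * j + 3 ≡ 3 * suc j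
  lemma = solve-∀
  below : ∀ {j x} → j < i → Within j x → x ≤ 3 * i
  below {j} j<i (_ , x≤) = ≤-trans x≤ (subst (_≤ 3 * i) (sym (lemma j)) (*-monoʳ-≤ 3 j<i))
  above : ∀ {j x} → j < t → Within (i + suc j) x → 3 * suc i ≤ x
  above {j} _ (x≥ , _) = ≤-trans (*-monoʳ-≤ 3 (subst (suc i ≤_) (sym (+-suc i j)) (s≤s (m≤m+n i j)))) x≥
  sandwich : count (closerᵉ lo hi) (left ++ mid ++ right) ≡ length left + count (closerᵉ lo hi) mid ×
             count (closerᵉ hi lo) (left ++ mid ++ right) ≡ count (closerᵉ hi lo) mid + length right
  sandwich = count-sandwich left mid right
    (All.map (λ (x≤ , y≤) → closer-step (cong₂ _⊓_ (rise-below {i = i} r x≤) (rise-below {i = i} r y≤)))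
             (All-squares id i below))
    (All.map (λ (x≥ , y≥) → closer-step (cong₂ _⊓_ (rise-above {i = i} r x≥) (rise-above {i = i} r y≥)))
             (All-squares _ t above))
  in-range : lo < 3 * n + 1 × hi < 3 * n + 1
  in-range = rise-in-range {i = i} {n} r (m<m+n i z<s)
  mid-lo : count (closerᵉ lo hi) mid ≡ 1
  mid-lo = trans (count-map {P = closerᵉ lo hi} (shift (3 * i)) (closerᵉ-shift i c c′) (squareEdges 0))
                 (proj₁ (rise-middle-edges r))
  mid-hi : count (closerᵉ hi lo) mid ≡ 1
  mid-hi = trans (count-map {P = closerᵉ hi lo} (shift (3 * i)) (closerᵉ-shift i c′ c) (squareEdges 0))
                 (proj₂ (rise-middle-edges r))
  length-left : length left ≡ 4 * i
  length-left = trans (length-concatMap-squareEdges (upTo i)) (cong (4 *_) (length-upTo i))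
  length-right : length right ≡ 4 * t
  length-right = trans (length-concatMap-squareEdges (applyUpTo (λ j → i + suc j) t))
                       (cong (4 *_) (length-applyUpTo (λ j → i + suc j) t))
  towards-lo : mEdge (Q n) lo hi ≡ 4 * i + 1
  towards-lo = begin
    mEdge (Q n) lo hi                             ≡⟨ mEdge-Q {n} (proj₁ in-range) (proj₂ in-range) ⟩
    count (closerᵉ lo hi) (E (Q n))               ≡⟨ cong (count (closerᵉ lo hi)) (edges-split i t) ⟩
    count (closerᵉ lo hi) (left ++ mid ++ right)  ≡⟨ proj₁ sandwich ⟩
    length left + count (closerᵉ lo hi) mid       ≡⟨ cong₂ _+_ length-left mid-lo ⟩
    4 * i + 1                                     ∎
  towards-hi : mEdge (Q n) hi lo ≡ 4 * t + 1
  towards-hi = begin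
    mEdge (Q n) hi lo                             ≡⟨ mEdge-Q {n} (proj₂ in-range) (proj₁ in-range) ⟩
    count (closerᵉ hi lo) (E (Q n))               ≡⟨ cong (count (closerᵉ hi lo)) (edges-split i t) ⟩
    count (closerᵉ hi lo) (left ++ mid ++ right)  ≡⟨ proj₂ sandwich ⟩
    count (closerᵉ hi lo) mid + length right      ≡⟨ cong₂ _+_ mid-hi length-right ⟩
    1 + 4 * t                                     ≡⟨ +-comm 1 (4 * t) ⟩
    4 * t + 1                                     ∎

-- Summing over the squares

edgeTerm : (ℕ → ℕ → ℕ) → ℕ → ℕ → ℕ
edgeTerm f x y = ∣ f x y - f y x ∣

edgeSum : (ℕ → ℕ → ℕ) → List (ℕ × ℕ) → ℕ
edgeSum f es = sum (map (λ e → edgeTerm f (proj₁ e) (proj₂ e)) es)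

edgeSum-concatMap : ∀ {A : Set} f (g : A → List (ℕ × ℕ)) xs →
                    edgeSum f (concatMap g xs) ≡ sum (map (edgeSum f ∘ g) xs)
edgeSum-concatMap f g []       = refl
edgeSum-concatMap f g (x ∷ xs) =
  trans (cong sum (map-++ _ (g x) (concatMap g xs)))
        (trans (sum-++ (map _ (g x)) _) (cong (edgeSum f (g x) +_) (edgeSum-concatMap f g xs)))

sum-map-*ˡ : ∀ {A : Set} k (f : A → ℕ) xs → sum (map (λ x → k * f x) xs) ≡ k * sum (map f xs)
sum-map-*ˡ k f []       = sym (*-zeroʳ k)
sum-map-*ˡ k f (x ∷ xs) = trans (cong (k * f x +_) (sum-map-*ˡ k f xs)) (sym (*-distribˡ-+ k (f x) _))

edgeSum-square : ∀ f i x → (∀ {c c′} → BaseRise c c′ → edgeTerm f (3 * i + c) (3 * i + c′) ≡ x) →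
                 edgeSum f (squareEdges i) ≡ 4 * x
edgeSum-square f i x rise = begin
  edgeSum f (squareEdges i)                       ≡⟨ cong (edgeSum f) (squareEdges-translate i) ⟩
  edgeSum f (map (shift (3 * i)) (squareEdges 0)) ≡⟨ cong₂ _+_ (rise 0↗1) (cong₂ _+_ (rise 1↗3)
                                                       (cong₂ _+_ (fall 2↗3) (cong (_+ 0) (fall 0↗2)))) ⟩
  x + (x + (x + (x + 0)))                         ≡⟨ lemma x ⟩
  4 * x                                           ∎
  where
  open ≡-Reasoning
  fall : ∀ {c c′} → BaseRise c c′ → edgeTerm f (3 * i + c′) (3 * i + c) ≡ x
  fall {c} {c′} r = trans (∣-∣-comm (f (3 * i + c′) (3 * i + c)) _) (rise r)
  lemma : ∀ x → x + (x + (x + (x + 0))) ≡ 4 * x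
  lemma = solve-∀

-- Square i has i squares to its left and n ∸ suc i to its right.
imbalance : ℕ → ℕ → ℕ
imbalance n i = ∣ i - (n ∸ suc i) ∣

imbalanceSum : ℕ → ℕ
imbalanceSum n = sum (map (imbalance n) (upTo n))

edgeSum-Q : (F : ℕ → ℕ → ℕ → ℕ) (a : ℕ) →
            (∀ {i t c c′} → BaseRise c c′ →
               edgeTerm (F (i + suc t)) (3 * i + c) (3 * i + c′) ≡ a * ∣ i - t ∣) →
            ∀ n → edgeSum (F n) (E (Q n)) ≡ 4 * a * imbalanceSum n
edgeSum-Q F a rise n = begin
  edgeSum (F n) (E (Q n))                           ≡⟨ edgeSum-concatMap (F n) squareEdges (upTo n) ⟩
  sum (map (edgeSum (F n) ∘ squareEdges) (upTo n))  ≡⟨ cong sum (map-cong-local (Allₚ.applyUpTo⁺₁ id n square)) ⟩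
  sum (map (λ i → 4 * a * imbalance n i) (upTo n))  ≡⟨ sum-map-*ˡ (4 * a) (imbalance n) (upTo n) ⟩
  4 * a * imbalanceSum n                            ∎
  where
  open ≡-Reasoning
  square : ∀ {i} → i < n → edgeSum (F n) (squareEdges i) ≡ 4 * a * imbalance n i
  square {i} i<n = begin
    edgeSum (F n) (squareEdges i)            ≡⟨ cong (λ m → edgeSum (F m) (squareEdges i)) n≡ ⟩
    edgeSum (F (i + suc t)) (squareEdges i)  ≡⟨ edgeSum-square (F (i + suc t)) i (a * ∣ i - t ∣) rise ⟩
    4 * (a * ∣ i - t ∣)                      ≡⟨ *-assoc 4 a _ ⟨
    4 * a * imbalance n i                    ∎
    where
    t : ℕ
    t = n ∸ suc i
    n≡ : n ≡ i + suc t
    n≡ = trans (sym (m+[n∸m]≡n i<n)) (sym (+-suc i t))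

Mo-Q : ∀ n → Mo (Q n) ≡ 12 * imbalanceSum n
Mo-Q = edgeSum-Q (λ n → nVert (Q n)) 3 (λ {i} {t} → rise {i} {t})
  where
  rise : ∀ {i t c c′} → BaseRise c c′ →
         edgeTerm (nVert (Q (i + suc t))) (3 * i + c) (3 * i + c′) ≡ 3 * ∣ i - t ∣
  rise {i} {t} r with nVert-rise {i} {t} r
  ... | to-lo , to-hi = trans (cong₂ ∣_-_∣ to-lo to-hi) (∣am+c-an+c∣≡a∣m-n∣ 3 2 i t)

Moₑ-Q : ∀ n → Moₑ (Q n) ≡ 16 * imbalanceSum n
Moₑ-Q = edgeSum-Q (λ n → mEdge (Q n)) 4 (λ {i} {t} → rise {i} {t})
  where
  rise : ∀ {i t c c′} → BaseRise c c′ →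
         edgeTerm (mEdge (Q (i + suc t))) (3 * i + c) (3 * i + c′) ≡ 4 * ∣ i - t ∣
  rise {i} {t} r with mEdge-rise {i} {t} r
  ... | to-lo , to-hi = trans (cong₂ ∣_-_∣ to-lo to-hi) (∣am+c-an+c∣≡a∣m-n∣ 4 1 i t)

imbalanceSum-step : ∀ n → imbalanceSum (2 + n) ≡ suc n + (imbalanceSum n + suc n)
imbalanceSum-step n = cong (suc n +_) (begin
  sum (map g (applyUpTo suc (suc n)))          ≡⟨ cong sum (map-applyUpTo suc g (suc n)) ⟩
  sum (applyUpTo (g ∘ suc) (suc n))            ≡⟨ cong sum (applyUpTo-∷ʳ (g ∘ suc) n) ⟨
  sum (applyUpTo (g ∘ suc) n ∷ʳ g (suc n))     ≡⟨ sum-++ (applyUpTo (g ∘ suc) n) (g (suc n) ∷ []) ⟩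
  sum (applyUpTo (g ∘ suc) n) + (g (suc n) + 0) ≡⟨ cong₂ _+_ inner last ⟩
  imbalanceSum n + suc n                       ∎)
  where
  open ≡-Reasoning
  g = imbalance (2 + n)
  inner : sum (applyUpTo (g ∘ suc) n) ≡ imbalanceSum n
  inner = cong sum (trans (sym (map-upTo (g ∘ suc) n)) (map-cong-local (Allₚ.applyUpTo⁺₁ id n shifted)))
    where
    shifted : ∀ {i} → i < n → g (suc i) ≡ imbalance n i
    shifted {i} i<n = cong (∣ suc i -_∣) (m∸n≡1+m∸[1+n] i<n)
  last : g (suc n) + 0 ≡ suc n
  last = trans (+-identityʳ _) (cong (∣ suc n -_∣) (n∸n≡0 n))

imbalanceSum-even : ∀ k → imbalanceSum (2 * k) ≡ 2 * (k * k)
imbalanceSum-even zero = refl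
imbalanceSum-even (suc k) = begin
  imbalanceSum (2 * suc k)                         ≡⟨ cong imbalanceSum (lemma₁ k) ⟩
  imbalanceSum (2 + 2 * k)                         ≡⟨ imbalanceSum-step (2 * k) ⟩
  suc (2 * k) + (imbalanceSum (2 * k) + suc (2 * k))
    ≡⟨ cong (λ s → suc (2 * k) + (s + suc (2 * k))) (imbalanceSum-even k) ⟩
  suc (2 * k) + (2 * (k * k) + suc (2 * k))        ≡⟨ lemma₂ k ⟩
  2 * (suc k * suc k)                              ∎
  where
  open ≡-Reasoning
  lemma₁ : ∀ k → 2 * suc k ≡ 2 + 2 * k
  lemma₁ = solve-∀
  lemma₂ : ∀ k → suc (2 * k) + (2 * (k * k) + suc (2 * k)) ≡ 2 * (suc k * suc k)
  lemma₂ = solve-∀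

imbalanceSum-odd : ∀ k → imbalanceSum (2 * k + 1) ≡ 2 * (k * k) + 2 * k
imbalanceSum-odd zero = refl
imbalanceSum-odd (suc k) = begin
  imbalanceSum (2 * suc k + 1)                     ≡⟨ cong imbalanceSum (lemma₁ k) ⟩
  imbalanceSum (2 + (2 * k + 1))                   ≡⟨ imbalanceSum-step (2 * k + 1) ⟩
  suc (2 * k + 1) + (imbalanceSum (2 * k + 1) + suc (2 * k + 1))
    ≡⟨ cong (λ s → suc (2 * k + 1) + (s + suc (2 * k + 1))) (imbalanceSum-odd k) ⟩
  suc (2 * k + 1) + ((2 * (k * k) + 2 * k) + suc (2 * k + 1)) ≡⟨ lemma₂ k ⟩
  2 * (suc k * suc k) + 2 * suc k                  ∎
  where
  open ≡-Reasoning
  lemma₁ : ∀ k → 2 * suc k + 1 ≡ 2 + (2 * k + 1)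
  lemma₁ = solve-∀
  lemma₂ : ∀ k → suc (2 * k + 1) + ((2 * (k * k) + 2 * k) + suc (2 * k + 1)) ≡ 2 * (suc k * suc k) + 2 * suc k
  lemma₂ = solve-∀

-- The formulas hold for k = 0 as well.
mainTheorem11 : (k : ℕ) → k ≥ 1 →
    ((Mo (Q (2 * k)) ≡ 24 * (k * k)) × (Mo (Q (2 * k + 1)) ≡ 24 * (k * k) + 24 * k))
    × ((Moₑ (Q (2 * k)) ≡ 32 * (k * k)) × (Moₑ (Q (2 * k + 1)) ≡ 32 * (k * k) + 32 * k))
mainTheorem11 k _ =
  ( trans (Mo-Q (2 * k))      (trans (cong (12 *_) (imbalanceSum-even k)) (even 12 k))
  , trans (Mo-Q (2 * k + 1))  (trans (cong (12 *_) (imbalanceSum-odd k))  (odd 12 k)) ) ,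
  ( trans (Moₑ-Q (2 * k))     (trans (cong (16 *_) (imbalanceSum-even k)) (even 16 k))
  , trans (Moₑ-Q (2 * k + 1)) (trans (cong (16 *_) (imbalanceSum-odd k))  (odd 16 k)) )
  where
  even : ∀ a k → a * (2 * (k * k)) ≡ (2 * a) * (k * k)
  even = solve-∀
  odd : ∀ a k → a * (2 * (k * k) + 2 * k) ≡ (2 * a) * (k * k) + (2 * a) * k
  odd = solve-∀
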